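{- Let $P=\{(n_0,\dots,n_5) \mid n_0+n_2+n_4=n_1+n_3+n_5,\ n_0\oplus n_1\oplus n_2=0,\ n_0\le n_3,\ n_1\le n_4,\ n_2\le n_5\}$. A position $M=(n_0,\dots,n_5)$ of ${\rm ECN}(6_{\{2,3\}},3)$ is a $\mathcal{P}$-position if and only if $M\in_\circlearrowleft P$.
   Context: Extended circular nim ${\rm ECN}(m_S,k)$ (positive integers $k\le m$, $S$ a set of positive integers each at most $m/2$): there are $m$ piles $v_0,\dots,v_{m-1}$ arranged in a circle (indices mod $m$); a position is a tuple $(n_0,\dots,n_{m-1})$ of nonnegative integers, $n_i$ being the number of tokens on $v_i$. A move chooses $s\in S$, $i\in\{0,\dots,m-1\}$, $j\in\{0,\dots,k-1\}$ and removes an arbitrary nonnegative number of tokens from each pile $v_{(i+ts)\bmod m}$, $t=0,\dots,j$, removing at least one token in total (empty piles still count as piles). Normal play: the player unable to move loses. A $\mathcal{P}$-position is a position from which the previous player (the player who just moved) has a winning strategy. $\oplus$ denotes bitwise exclusive OR (nim-sum). For a set $P$ of $m$-tuples and $M=(n_0,\dots,n_{m-1})$, $M\in_\circlearrowleft P$ means there exists $i<m$ such that $(n_i,n_{(i+1)\bmod m},\dots,n_{(i+m-1)\bmod m})\in P$ or $(n_i,n_{(i+m-1)\bmod m},\dots,n_{(i+1)\bmod m})\in P$. -}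

module Defs where

open import Data.Nat using (ℕ; zero; suc; _+_; _*_; _∸_; _≤_; _<_; NonZero)
open import Data.Nat.DivMod using (_%_; _/_; _mod_)
open import Data.Fin using (Fin; toℕ)
open import Data.Fin.Patterns using (0F; 1F; 2F; 3F; 4F; 5F)
open import Data.List using (List; _∷_; [])
open import Data.List.Membership.Propositional using (_∈_)
open import Data.Product using (Σ; ∃; _×_; _,_)
open import Data.Sum using (_⊎_)
open import Relation.Binary.PropositionalEquality using (_≡_)

-- Bitwise exclusive OR (nim-sum) on ℕ, computed bit by bit.
-- The fuel a + b is always enough: each step halves both arguments.
xorFuel : ℕ → ℕ → ℕ → ℕ
xorFuel zero    a b = 0
xorFuel (suc f) a b = ((a % 2) + (b % 2)) % 2 + 2 * xorFuel f (a / 2) (b / 2)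

infixl 6 _⊕_
_⊕_ : ℕ → ℕ → ℕ
a ⊕ b = xorFuel (a + b) a b

Position : ℕ → Set
Position m = Fin m → ℕ

Selected : (m : ℕ) .{{_ : NonZero m}} → (s : ℕ) → Fin m → (j : ℕ) → Fin m → Set
Selected m s i j p = Σ ℕ λ t → t ≤ j × toℕ p ≡ (toℕ i + t * s) % m

ECNMove : (m : ℕ) .{{_ : NonZero m}} → List ℕ → ℕ → Position m → Position m → Set
ECNMove m S k M M' =
  Σ ℕ λ s → s ∈ S × Σ (Fin m) λ i → Σ ℕ λ j → j < k ×
    ( (∀ p → M' p ≤ M p)
    × (∀ p → Selected m s i j p ⊎ M' p ≡ M p)
    × ∃ λ p → M' p < M p )

-- Outcome classes of a normal-play impartial game given by a move relation
-- (all games here are finite: every move decreases the token total).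
mutual
  data IsP {Pos : Set} (Move : Pos → Pos → Set) (M : Pos) : Set where
    allToN : (∀ M' → Move M M' → IsN Move M') → IsP Move M

  data IsN {Pos : Set} (Move : Pos → Pos → Set) (M : Pos) : Set where
    someToP : (M' : Pos) → Move M M' → IsP Move M' → IsN Move M

ECN-P-position : (m : ℕ) .{{_ : NonZero m}} → List ℕ → ℕ → Position m → Set
ECN-P-position m S k = IsP (ECNMove m S k)

_∈↺_ : {m : ℕ} .{{_ : NonZero m}} → Position m → (Position m → Set) → Set
_∈↺_ {m} M P = Σ (Fin m) λ i →
    P (λ p → M ((toℕ i + toℕ p) mod m))
  ⊎ P (λ p → M ((toℕ i + (m ∸ toℕ p)) mod m))

P6 : Position 6 → Set
P6 n =
    n 0F + n 2F + n 4F ≡ n 1F + n 3F + n 5F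
  × (n 0F ⊕ n 1F ⊕ n 2F) ≡ 0
  × n 0F ≤ n 3F
  × n 1F ≤ n 4F
  × n 2F ≤ n 5F

-- Call a position balanced when its even and odd piles have equal sums and the minima of the
-- three opposite pairs have nim-sum 0. For a tuple in P these minima are n₀, n₁, n₂, and every
-- balanced position is a rotation of such a tuple, because once two opposite pairs are ordered
-- the sum condition orders the third; so M ∈↺ P exactly when M is balanced.
--
-- As 2 and 3 divide 6, a move lowers piles of one parity class or of one opposite pair. No move
-- joins two balanced positions: a parity move changes one side of the sum equation only, and a
-- pair move keeps the other two minima, so the pair keeps its minimum (by nim-cancellation) and
-- its difference (by the sum equation). Conversely every position can be balanced. Rotate so
-- that the evens are at least as heavy as the odds. If the minima have nim-sum 0, lower the
-- evens to the weight of the odds without crossing the minima. Otherwise Bouton's lemma lowers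
-- one minimum to some t; reset that pair to minimum t with the difference that equalises the
-- sums, or, if the pair is too small for that, lower its even pile to t and balance the evens.
-- The balanced positions are thus a kernel of the terminating game graph, which is exactly the
-- set of P-positions.

module Submission where

open import Defs
open import Data.Bool using (Bool; true; false; T; _xor_)
open import Data.Bool.Properties using (xor-assoc; xor-comm; xor-same; xor-identityʳ)
import Data.Bool.Properties as Bool
open import Data.Fin using (Fin; toℕ; _↑ˡ_)
import Data.Fin as Fin
open import Data.Fin.Patterns using (0F; 1F; 2F; 3F; 4F; 5F)
open import Data.Fin.Properties using (all?; ¬∀⟶∃¬; toℕ<n; toℕ≤pred[n]; toℕ-fromℕ<; toℕ-↑ˡ)
open import Data.List using (_∷_; [])
open import Data.List.Membership.Propositional using (_∈_)
open import Data.List.Relation.Unary.Any using (here; there)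
open import Data.Nat using (ℕ; zero; suc; _+_; _*_; _∸_; _≤_; _<_; _⊓_; z≤n; s≤s; _≡ᵇ_; _≟_; _≤?_; NonZero)
open import Data.Nat.Divisibility using (_∣_; divides; n∣m*n)
open import Data.Nat.DivMod
  using (_%_; _/_; _mod_; m/n*n≤m; [m+kn]%n≡m%n; m<n⇒m%n≡m; m<n⇒m/n≡0; m*n/n≡m; +-distrib-/-∣ʳ;
         m∣n⇒o%n%m≡o%m; m≡m%n+[m/n]*n; /-mono-≤)
open import Data.Nat.Induction using (<-wellFounded)
open import Data.Nat.Properties
open import Algebra.Properties.CommutativeSemigroup +-commutativeSemigroup
  using (xy∙z≈y∙xz; xy∙z≈yz∙x; xy∙z≈zx∙y; xy∙z≈zy∙x; xy∙z≈xz∙y)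
open import Data.Nat.Tactic.RingSolver using (solve-∀)
open import Data.Product using (∃; ∃₂; _×_; _,_; proj₁; proj₂)
open import Data.Sum using (_⊎_; inj₁; inj₂)
import Data.Sum as Sum
open import Function using (_∘_; id)
open import Function.Bundles using (_⇔_; mk⇔)
open import Function.Construct.Composition using (_⇔-∘_)
open import Induction.WellFounded using (Acc; acc)
open import Relation.Binary using (DecidableEquality)
open import Relation.Binary.PropositionalEquality
open import Relation.Nullary using (¬_; Dec; yes; no; contradiction)
open import Relation.Nullary.Decidable using (True; toWitness; T?; decidable-stable)
open import Relation.Unary using (Decidable)

-- Nim-sums

bit : Bool → ℕ
bit false = 0
bit true  = 1

bit<2 : ∀ b → bit b < 2
bit<2 false = s≤s z≤n
bit<2 true  = s≤s (s≤s z≤n)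

data Digits : ℕ → Set where
  digits : ∀ b h → Digits (bit b + 2 * h)

digits? : ∀ n → Digits n
digits? zero          = digits false 0
digits? (suc zero)    = digits true 0
digits? (suc (suc n)) with digits? n
... | digits b h = subst Digits (two-more (bit b) h) (digits b (suc h))
  where
  two-more : ∀ x h → x + 2 * suc h ≡ suc (suc (x + 2 * h))
  two-more = solve-∀

[bit+2h]%2≡bit : ∀ b h → (bit b + 2 * h) % 2 ≡ bit b
[bit+2h]%2≡bit b h = begin
  (bit b + 2 * h) % 2  ≡⟨ cong (λ x → (bit b + x) % 2) (*-comm 2 h) ⟩
  (bit b + h * 2) % 2  ≡⟨ [m+kn]%n≡m%n (bit b) h 2 ⟩
  bit b % 2            ≡⟨ m<n⇒m%n≡m (bit<2 b) ⟩
  bit b                ∎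
  where open ≡-Reasoning

[bit+2h]/2≡h : ∀ b h → (bit b + 2 * h) / 2 ≡ h
[bit+2h]/2≡h b h = begin
  (bit b + 2 * h) / 2    ≡⟨ cong (λ x → (bit b + x) / 2) (*-comm 2 h) ⟩
  (bit b + h * 2) / 2    ≡⟨ +-distrib-/-∣ʳ (bit b) (n∣m*n h) ⟩
  bit b / 2 + h * 2 / 2  ≡⟨ cong₂ _+_ (m<n⇒m/n≡0 (bit<2 b)) (m*n/n≡m h 2) ⟩
  h                      ∎
  where open ≡-Reasoning

[bit+bit]%2≡bit-xor : ∀ b c → (bit b + bit c) % 2 ≡ bit (b xor c)
[bit+bit]%2≡bit-xor false false = refl
[bit+bit]%2≡bit-xor false true  = refl
[bit+bit]%2≡bit-xor true  false = refl
[bit+bit]%2≡bit-xor true  true  = refl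

2*m≤1+n⇒m≤n : ∀ {m n} → 2 * m ≤ suc n → m ≤ n
2*m≤1+n⇒m≤n {zero}  _ = z≤n
2*m≤1+n⇒m≤n {suc m} {n} h = ≤-trans (s≤s (m≤n*m m 2)) (≤-pred (subst (_≤ suc n) (*-suc 2 m) h))

2*[m/2]≤m : ∀ m → 2 * (m / 2) ≤ m
2*[m/2]≤m m = ≤-trans (≤-reflexive (*-comm 2 (m / 2))) (m/n*n≤m m 2)

m+n≤1+o⇒m/2+n/2≤o : ∀ m n {o} → m + n ≤ suc o → m / 2 + n / 2 ≤ o
m+n≤1+o⇒m/2+n/2≤o m n h = 2*m≤1+n⇒m≤n (begin
  2 * (m / 2 + n / 2)          ≡⟨ *-distribˡ-+ 2 (m / 2) (n / 2) ⟩
  2 * (m / 2) + 2 * (n / 2)    ≤⟨ +-mono-≤ (2*[m/2]≤m m) (2*[m/2]≤m n) ⟩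
  m + n                        ≤⟨ h ⟩
  _                            ∎)
  where open ≤-Reasoning

xorFuel-0-0 : ∀ f → xorFuel f 0 0 ≡ 0
xorFuel-0-0 zero    = refl
xorFuel-0-0 (suc f) = cong (2 *_) (xorFuel-0-0 f)

xorFuel-irrelevant : ∀ f g a b → a + b ≤ f → a + b ≤ g → xorFuel f a b ≡ xorFuel g a b
xorFuel-irrelevant zero    zero    _       _       _  _  = refl
xorFuel-irrelevant zero    (suc g) zero    zero    _  _  = sym (cong (2 *_) (xorFuel-0-0 g))
xorFuel-irrelevant zero    (suc g) zero    (suc b) () _
xorFuel-irrelevant zero    (suc g) (suc a) b       () _
xorFuel-irrelevant (suc f) zero    zero    zero    _  _  = cong (2 *_) (xorFuel-0-0 f)
xorFuel-irrelevant (suc f) zero    zero    (suc b) _  ()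
xorFuel-irrelevant (suc f) zero    (suc a) b       _  ()
xorFuel-irrelevant (suc f) (suc g) a       b       p  q  =
  cong (λ x → (a % 2 + b % 2) % 2 + 2 * x)
       (xorFuel-irrelevant f g (a / 2) (b / 2) (m+n≤1+o⇒m/2+n/2≤o a b p) (m+n≤1+o⇒m/2+n/2≤o a b q))

⊕-unfold : ∀ a b → a ⊕ b ≡ (a % 2 + b % 2) % 2 + 2 * (a / 2 ⊕ b / 2)
⊕-unfold a b = unfold (a + b) refl
  where
  unfold : ∀ f → a + b ≡ f → xorFuel f a b ≡ (a % 2 + b % 2) % 2 + 2 * (a / 2 ⊕ b / 2)
  unfold zero    eq with m+n≡0⇒m≡0 a eq | m+n≡0⇒n≡0 a eq
  ... | refl | refl = refl
  unfold (suc f) eq = cong (λ x → (a % 2 + b % 2) % 2 + 2 * x)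
    (xorFuel-irrelevant f (a / 2 + b / 2) (a / 2) (b / 2) (m+n≤1+o⇒m/2+n/2≤o a b (≤-reflexive eq)) ≤-refl)

⊕-digits : ∀ b c h k → (bit b + 2 * h) ⊕ (bit c + 2 * k) ≡ bit (b xor c) + 2 * (h ⊕ k)
⊕-digits b c h k
  rewrite ⊕-unfold (bit b + 2 * h) (bit c + 2 * k)
        | [bit+2h]%2≡bit b h | [bit+2h]%2≡bit c k | [bit+2h]/2≡h b h | [bit+2h]/2≡h c k
        | [bit+bit]%2≡bit-xor b c = refl

⊕-digits₃ : ∀ b c d h k l →
  (bit b + 2 * h) ⊕ (bit c + 2 * k) ⊕ (bit d + 2 * l) ≡ bit ((b xor c) xor d) + 2 * (h ⊕ k ⊕ l)
⊕-digits₃ b c d h k l =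
  trans (cong (_⊕ (bit d + 2 * l)) (⊕-digits b c h k)) (⊕-digits (b xor c) d (h ⊕ k) l)

binary-induction : (P : ℕ → ℕ → ℕ → Set) → P 0 0 0 →
  (∀ b c d h k l → P h k l → P (bit b + 2 * h) (bit c + 2 * k) (bit d + 2 * l)) →
  ∀ a b c → P a b c
binary-induction P base step a b c = go (a + b + c) a b c ≤-refl
  where
  halves-≤ : ∀ {n} b c d h k l → (bit b + 2 * h) + (bit c + 2 * k) + (bit d + 2 * l) ≤ suc n → h + k + l ≤ n
  halves-≤ {n} b c d h k l bound = 2*m≤1+n⇒m≤n (begin
    2 * (h + k + l)
      ≡⟨ *-distribˡ-+ 2 (h + k) l ⟩
    2 * (h + k) + 2 * l
      ≡⟨ cong (_+ 2 * l) (*-distribˡ-+ 2 h k) ⟩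
    2 * h + 2 * k + 2 * l
      ≤⟨ +-mono-≤ (+-mono-≤ (m≤n+m _ (bit b)) (m≤n+m _ (bit c))) (m≤n+m _ (bit d)) ⟩
    (bit b + 2 * h) + (bit c + 2 * k) + (bit d + 2 * l)
      ≤⟨ bound ⟩
    suc n ∎)
    where open ≤-Reasoning
  go : ∀ n a b c → a + b + c ≤ n → P a b c
  go zero    zero    zero    zero    _ = base
  go zero    (suc a) b       c       ()
  go zero    zero    (suc b) c       ()
  go zero    zero    zero    (suc c) ()
  go (suc n) a b c bound with digits? a | digits? b | digits? c
  ... | digits x h | digits y k | digits z l = step x y z h k l (go n h k l (halves-≤ x y z h k l bound))

⊕-comm : ∀ a b → a ⊕ b ≡ b ⊕ a
⊕-comm a b = binary-induction (λ a b _ → a ⊕ b ≡ b ⊕ a) refl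
  (λ b c _ h k _ ih → begin
    (bit b + 2 * h) ⊕ (bit c + 2 * k)  ≡⟨ ⊕-digits b c h k ⟩
    bit (b xor c) + 2 * (h ⊕ k)        ≡⟨ cong₂ (λ x y → bit x + 2 * y) (xor-comm b c) ih ⟩
    bit (c xor b) + 2 * (k ⊕ h)        ≡⟨ ⊕-digits c b k h ⟨
    (bit c + 2 * k) ⊕ (bit b + 2 * h)  ∎)
  a b 0
  where open ≡-Reasoning

⊕-identityʳ : ∀ a → a ⊕ 0 ≡ a
⊕-identityʳ a = binary-induction (λ a _ _ → a ⊕ 0 ≡ a) refl
  (λ b _ _ h _ _ ih → trans (⊕-digits b false h 0) (cong₂ (λ x y → bit x + 2 * y) (xor-identityʳ b) ih))
  a 0 0

⊕-self : ∀ a → a ⊕ a ≡ 0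
⊕-self a = binary-induction (λ a _ _ → a ⊕ a ≡ 0) refl
  (λ b _ _ h _ _ ih → trans (⊕-digits b b h h) (cong₂ (λ x y → bit x + 2 * y) (xor-same b) ih))
  a 0 0

⊕-assoc : ∀ a b c → a ⊕ b ⊕ c ≡ a ⊕ (b ⊕ c)
⊕-assoc = binary-induction (λ a b c → a ⊕ b ⊕ c ≡ a ⊕ (b ⊕ c)) refl
  λ b c d h k l ih → begin
    (bit b + 2 * h) ⊕ (bit c + 2 * k) ⊕ (bit d + 2 * l)
      ≡⟨ ⊕-digits₃ b c d h k l ⟩
    bit ((b xor c) xor d) + 2 * (h ⊕ k ⊕ l)
      ≡⟨ cong₂ (λ x y → bit x + 2 * y) (xor-assoc b c d) ih ⟩
    bit (b xor (c xor d)) + 2 * (h ⊕ (k ⊕ l))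
      ≡⟨ ⊕-digits b (c xor d) h (k ⊕ l) ⟨
    (bit b + 2 * h) ⊕ (bit (c xor d) + 2 * (k ⊕ l))
      ≡⟨ cong ((bit b + 2 * h) ⊕_) (⊕-digits c d k l) ⟨
    (bit b + 2 * h) ⊕ ((bit c + 2 * k) ⊕ (bit d + 2 * l))  ∎
  where open ≡-Reasoning

⊕≡0⇒≡ : ∀ a b → a ⊕ b ≡ 0 → a ≡ b
⊕≡0⇒≡ a b eq = begin
  a            ≡⟨ ⊕-identityʳ a ⟨
  a ⊕ 0        ≡⟨ cong (a ⊕_) (⊕-self b) ⟨
  a ⊕ (b ⊕ b)  ≡⟨ ⊕-assoc a b b ⟨
  a ⊕ b ⊕ b    ≡⟨ cong (_⊕ b) eq ⟩
  0 ⊕ b        ≡⟨ ⊕-comm 0 b ⟩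
  b ⊕ 0        ≡⟨ ⊕-identityʳ b ⟩
  b            ∎
  where open ≡-Reasoning

record NimZero (a b c : ℕ) : Set where
  constructor nimZero
  field ⊕≡0 : a ⊕ b ⊕ c ≡ 0

NimZero-cong : ∀ {a a′ b b′ c c′} → a ≡ a′ → b ≡ b′ → c ≡ c′ → NimZero a b c → NimZero a′ b′ c′
NimZero-cong refl refl refl z = z

NimZero-unique : ∀ {a a′ b c} → NimZero a b c → NimZero a′ b c → a ≡ a′
NimZero-unique {a} {a′} {b} {c} (nimZero z) (nimZero z′) =
  trans (⊕≡0⇒≡ a (b ⊕ c) (trans (sym (⊕-assoc a b c)) z))
        (sym (⊕≡0⇒≡ a′ (b ⊕ c) (trans (sym (⊕-assoc a′ b c)) z′)))

NimZero-swap : ∀ {a b c} → NimZero a b c → NimZero b a c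
NimZero-swap {a} {b} {c} (nimZero z) = nimZero (trans (cong (_⊕ c) (⊕-comm b a)) z)

NimZero-rotate : ∀ {a b c} → NimZero a b c → NimZero b c a
NimZero-rotate {a} {b} {c} (nimZero z) = nimZero (trans (trans (⊕-comm (b ⊕ c) a) (sym (⊕-assoc a b c))) z)

bit+2*-mono-< : ∀ b c {h k} → h < k → bit b + 2 * h < bit c + 2 * k
bit+2*-mono-< b c {h} {k} h<k = begin-strict
  bit b + 2 * h   ≤⟨ +-monoˡ-≤ (2 * h) (≤-pred (bit<2 b)) ⟩
  1 + 2 * h       <⟨ n<1+n (1 + 2 * h) ⟩
  2 + 2 * h       ≡⟨ *-suc 2 h ⟨
  2 * suc h       ≤⟨ *-monoʳ-≤ 2 h<k ⟩
  2 * k           ≤⟨ m≤n+m (2 * k) (bit c) ⟩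
  bit c + 2 * k   ∎
  where open ≤-Reasoning

nim-sum-lowers : ∀ a b c → a ⊕ b ⊕ c ≢ 0 →
  a ⊕ (a ⊕ b ⊕ c) < a ⊎ b ⊕ (a ⊕ b ⊕ c) < b ⊎ c ⊕ (a ⊕ b ⊕ c) < c
nim-sum-lowers = binary-induction P (λ ne → contradiction refl ne) step
  where
  P : ℕ → ℕ → ℕ → Set
  P a b c = a ⊕ b ⊕ c ≢ 0 → a ⊕ (a ⊕ b ⊕ c) < a ⊎ b ⊕ (a ⊕ b ⊕ c) < b ⊎ c ⊕ (a ⊕ b ⊕ c) < c

  top-digit : ∀ x y z {h k l} → bit ((x xor y) xor z) + 2 * 0 ≢ 0 →
    bit (x xor ((x xor y) xor z)) + 2 * h < bit x + 2 * h ⊎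
    bit (y xor ((x xor y) xor z)) + 2 * k < bit y + 2 * k ⊎
    bit (z xor ((x xor y) xor z)) + 2 * l < bit z + 2 * l
  top-digit true  true  true  _  = inj₁ ≤-refl
  top-digit true  false false _  = inj₁ ≤-refl
  top-digit false true  false _  = inj₂ (inj₁ ≤-refl)
  top-digit false false true  _  = inj₂ (inj₂ ≤-refl)
  top-digit true  true  false ne = contradiction refl ne
  top-digit true  false true  ne = contradiction refl ne
  top-digit false true  true  ne = contradiction refl ne
  top-digit false false false ne = contradiction refl ne

  -- If the halves have nonzero nim-sum, the heap lowered for them works; otherwise the
  -- nim-sum is 1 and any odd heap drops by one.
  step : ∀ x y z h k l → P h k l → P (bit x + 2 * h) (bit y + 2 * k) (bit z + 2 * l)
  step x y z h k l ih ne
    rewrite ⊕-digits₃ x y z h k l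
          | ⊕-digits x ((x xor y) xor z) h (h ⊕ k ⊕ l)
          | ⊕-digits y ((x xor y) xor z) k (h ⊕ k ⊕ l)
          | ⊕-digits z ((x xor y) xor z) l (h ⊕ k ⊕ l)
    with h ⊕ k ⊕ l ≟ 0
  ... | no s≢0 = Sum.map (bit+2*-mono-< (x xor σ) x)
                         (Sum.map (bit+2*-mono-< (y xor σ) y) (bit+2*-mono-< (z xor σ) z))
                         (ih s≢0)
    where σ = (x xor y) xor z
  ... | yes s≡0 rewrite s≡0 | ⊕-identityʳ h | ⊕-identityʳ k | ⊕-identityʳ l = top-digit x y z {h} {k} {l} ne

nim-move : ∀ a b c → a ⊕ b ⊕ c ≢ 0 →
  (∃ λ t → t < a × NimZero t b c) ⊎ (∃ λ t → t < b × NimZero a t c) ⊎ (∃ λ t → t < c × NimZero a b t)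
nim-move a b c ne =
  Sum.map (λ lt → _ , lt , lowered a b c) (Sum.map (λ lt → _ , lt , via-b) (λ lt → _ , lt , via-c))
          (nim-sum-lowers a b c ne)
  where
  open ≡-Reasoning
  lowered : ∀ a b c → NimZero (a ⊕ (a ⊕ b ⊕ c)) b c
  lowered a b c = nimZero (begin
    a ⊕ s ⊕ b ⊕ c        ≡⟨ cong (λ x → x ⊕ b ⊕ c) (⊕-comm a s) ⟩
    s ⊕ a ⊕ b ⊕ c        ≡⟨ cong (_⊕ c) (⊕-assoc s a b) ⟩
    s ⊕ (a ⊕ b) ⊕ c      ≡⟨ ⊕-assoc s (a ⊕ b) c ⟩
    s ⊕ s                ≡⟨ ⊕-self s ⟩
    0                    ∎)
    where s = a ⊕ b ⊕ c
  via-b : NimZero a (b ⊕ (a ⊕ b ⊕ c)) c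
  via-b = NimZero-swap (subst (λ s → NimZero (b ⊕ s) a c) (cong (_⊕ c) (⊕-comm b a)) (lowered b a c))
  via-c : NimZero a b (c ⊕ (a ⊕ b ⊕ c))
  via-c = NimZero-rotate (subst (λ s → NimZero (c ⊕ s) a b) (trans (⊕-assoc c a b) (⊕-comm c (a ⊕ b)))
                                (lowered c a b))

-- P-positions of terminating games

module _ {Pos : Set} {Move : Pos → Pos → Set} where

  IsP-IsN-disjoint : ∀ {M} → IsP Move M → ¬ IsN Move M
  IsP-IsN-disjoint (allToN toN) (someToP M′ mv p) = IsP-IsN-disjoint p (toN M′ mv)

  IsP⇔kernel : (K : Pos → Set) → Decidable K → (size : Pos → ℕ) →
    (∀ {M M′} → Move M M′ → size M′ < size M) →
    (∀ {M M′} → K M → Move M M′ → ¬ K M′) →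
    (∀ {M} → ¬ K M → ∃ λ M′ → Move M M′ × K M′) →
    ∀ M → IsP Move M ⇔ K M
  IsP⇔kernel K K? size shrinks independent absorbing M =
    mk⇔ fromP (proj₁ (classify M (<-wellFounded (size M))))
    where
    classify : ∀ M → Acc _<_ (size M) → (K M → IsP Move M) × (¬ K M → IsN Move M)
    classify M (acc rec) =
        (λ k → allToN λ M′ mv → proj₂ (classify M′ (rec (shrinks mv))) (independent k mv))
      , (λ ¬k → let (M′ , mv , k′) = absorbing ¬k in
                someToP M′ mv (proj₁ (classify M′ (rec (shrinks mv))) k′))
    fromP : IsP Move M → K M
    fromP p with K? M
    ... | yes k = k
    ... | no ¬k = contradiction (proj₂ (classify M (<-wellFounded (size M))) ¬k) (IsP-IsN-disjoint p)

⊓-between : ∀ {a a′ b} → a ⊓ b ≤ a′ → a′ ≤ a → a′ ⊓ b ≡ a ⊓ b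
⊓-between {a} {a′} {b} lo hi with ≤-total a b
... | inj₁ a≤b = cong (_⊓ b) (≤-antisym hi (subst (_≤ a′) (m≤n⇒m⊓n≡m a≤b) lo))
... | inj₂ b≤a = trans (m≥n⇒m⊓n≡n (subst (_≤ a′) (m≥n⇒m⊓n≡n b≤a) lo)) (sym (m≥n⇒m⊓n≡n b≤a))

pair-rigid : ∀ {a b a′ b′ x y} → a′ ≤ a → b′ ≤ b → a′ ⊓ b′ ≡ a ⊓ b →
  a′ + x ≡ b′ + y → a + x ≡ b + y → a′ ≡ a × b′ ≡ b
pair-rigid {a} {b} {a′} {b′} {x} {y} a′≤a b′≤b min≡ sum′ sum with ≤-total a b
... | inj₁ a≤b = a′≡a , +-cancelʳ-≡ y b′ b (trans (sym sum′) (trans (cong (_+ x) a′≡a) sum))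
  where
  a′≡a : a′ ≡ a
  a′≡a = ≤-antisym a′≤a (begin
    a        ≡⟨ m≤n⇒m⊓n≡m a≤b ⟨
    a ⊓ b    ≡⟨ min≡ ⟨
    a′ ⊓ b′  ≤⟨ m⊓n≤m a′ b′ ⟩
    a′       ∎)
    where open ≤-Reasoning
... | inj₂ b≤a = +-cancelʳ-≡ x a′ a (trans sum′ (trans (cong (_+ y) b′≡b) (sym sum))) , b′≡b
  where
  b′≡b : b′ ≡ b
  b′≡b = ≤-antisym b′≤b (begin
    b        ≡⟨ m≥n⇒m⊓n≡n b≤a ⟨
    a ⊓ b    ≡⟨ min≡ ⟨
    a′ ⊓ b′  ≤⟨ m⊓n≤n a′ b′ ⟩
    b′       ∎)
    where open ≤-Reasoning

middle-ordered : ∀ {a₀ a₁ a₂ a₃ a₄ a₅} → a₀ + a₂ + a₄ ≡ a₁ + a₃ + a₅ → a₀ ≤ a₃ → a₂ ≤ a₅ → a₁ ≤ a₄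
middle-ordered {a₀} {a₁} {a₂} {a₃} {a₄} {a₅} sums l₀ l₂ = +-cancelʳ-≤ (a₃ + a₅) a₁ a₄ (begin
  a₁ + (a₃ + a₅)   ≡⟨ +-assoc a₁ a₃ a₅ ⟨
  a₁ + a₃ + a₅     ≡⟨ sums ⟨
  a₀ + a₂ + a₄     ≤⟨ +-monoˡ-≤ a₄ (+-mono-≤ l₀ l₂) ⟩
  a₃ + a₅ + a₄     ≡⟨ +-comm (a₃ + a₅) a₄ ⟩
  a₄ + (a₃ + a₅)   ∎)
  where open ≤-Reasoning

interval-sum : ∀ {lo₀ hi₀ lo₁ hi₁ T} → lo₀ ≤ hi₀ → lo₁ ≤ hi₁ → lo₀ + lo₁ ≤ T → T ≤ hi₀ + hi₁ →
  ∃₂ λ v₀ v₁ → (lo₀ ≤ v₀ × v₀ ≤ hi₀) × (lo₁ ≤ v₁ × v₁ ≤ hi₁) × v₀ + v₁ ≡ T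
interval-sum {lo₀} {hi₀} {lo₁} {hi₁} {T} lo₀≤hi₀ lo₁≤hi₁ lo≤T T≤hi =
  v₀ , T ∸ v₀ , (⊓-glb lo₀≤hi₀ (m+n≤o⇒m≤o∸n lo₀ lo≤T) , m⊓n≤m hi₀ (T ∸ lo₁)) ,
  (lo₁≤T∸v₀ , T∸v₀≤hi₁) , m+[n∸m]≡n v₀≤T
  where
  v₀ = hi₀ ⊓ (T ∸ lo₁)
  lo₁≤T : lo₁ ≤ T
  lo₁≤T = m+n≤o⇒n≤o lo₀ lo≤T
  v₀≤T : v₀ ≤ T
  v₀≤T = ≤-trans (m⊓n≤n hi₀ (T ∸ lo₁)) (m∸n≤m T lo₁)
  lo₁≤T∸v₀ : lo₁ ≤ T ∸ v₀
  lo₁≤T∸v₀ = m+n≤o⇒m≤o∸n lo₁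
    (subst (_≤ T) (+-comm v₀ lo₁) (m≤o∸n⇒m+n≤o v₀ lo₁≤T (m⊓n≤n hi₀ (T ∸ lo₁))))
  T∸v₀≤hi₁ : T ∸ v₀ ≤ hi₁
  T∸v₀≤hi₁ with ≤-total hi₀ (T ∸ lo₁)
  ... | inj₁ le rewrite m≤n⇒m⊓n≡m le = m≤n+o⇒m∸n≤o T hi₀ T≤hi
  ... | inj₂ ge rewrite m≥n⇒m⊓n≡n ge | m∸[m∸n]≡n lo₁≤T = lo₁≤hi₁

interval-sum₃ : ∀ {lo₀ hi₀ lo₁ hi₁ lo₂ hi₂ T} → lo₀ ≤ hi₀ → lo₁ ≤ hi₁ → lo₂ ≤ hi₂ →
  lo₀ + lo₁ + lo₂ ≤ T → T ≤ hi₀ + hi₁ + hi₂ →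
  ∃₂ λ v₀ v₁ → ∃ λ v₂ → (lo₀ ≤ v₀ × v₀ ≤ hi₀) × (lo₁ ≤ v₁ × v₁ ≤ hi₁) × (lo₂ ≤ v₂ × v₂ ≤ hi₂) × v₀ + v₁ + v₂ ≡ T
interval-sum₃ {lo₀} {hi₀} {lo₁} {hi₁} {lo₂} {hi₂} {T} l₀ l₁ l₂ lo≤T T≤hi
  with interval-sum l₀ (+-mono-≤ l₁ l₂) (subst (_≤ T) (+-assoc lo₀ lo₁ lo₂) lo≤T)
                      (subst (T ≤_) (+-assoc hi₀ hi₁ hi₂) T≤hi)
... | v₀ , w , r₀ , (lo≤w , w≤hi) , sum with interval-sum l₁ l₂ lo≤w w≤hi
...   | v₁ , v₂ , r₁ , r₂ , sum′ =
  v₀ , v₁ , v₂ , r₀ , r₁ , r₂ , trans (+-assoc v₀ v₁ v₂) (trans (cong (v₀ +_) sum′) sum)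

m+[n∸o]+o≡m+n : ∀ m {n o} → o ≤ n → m + (n ∸ o) + o ≡ m + n
m+[n∸o]+o≡m+n m {n} {o} o≤n = trans (+-assoc m (n ∸ o) o) (cong (m +_) (m∸n+n≡m o≤n))

offsets-⊓ : ∀ t x y → (t + (y ∸ x)) ⊓ (t + (x ∸ y)) ≡ t
offsets-⊓ t x y with ≤-total x y
... | inj₁ x≤y rewrite m≤n⇒m∸n≡0 x≤y | +-identityʳ t = m≥n⇒m⊓n≡n (m≤m+n t (y ∸ x))
... | inj₂ y≤x rewrite m≤n⇒m∸n≡0 y≤x | +-identityʳ t = m≤n⇒m⊓n≡m (m≤m+n t (x ∸ y))

offsets-balance : ∀ t x y → t + (y ∸ x) + x ≡ t + (x ∸ y) + y
offsets-balance t x y with ≤-total x y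
... | inj₁ x≤y rewrite m≤n⇒m∸n≡0 x≤y | +-identityʳ t = m+[n∸o]+o≡m+n t x≤y
... | inj₂ y≤x rewrite m≤n⇒m∸n≡0 y≤x | +-identityʳ t = sym (m+[n∸o]+o≡m+n t y≤x)

offset-≤ : ∀ {t n x y} → t ≤ n → t + y ≤ n + x → t + (y ∸ x) ≤ n
offset-≤ {t} {n} {x} {y} t≤n bound with ≤-total x y
... | inj₁ x≤y = +-cancelʳ-≤ x (t + (y ∸ x)) n (≤-trans (≤-reflexive (m+[n∸o]+o≡m+n t x≤y)) bound)
... | inj₂ y≤x rewrite m≤n⇒m∸n≡0 y≤x | +-identityʳ t = t≤n

offset-≰ : ∀ {t n x y} → t ≤ n → ¬ (t + (x ∸ y) ≤ n) → n + y < t + x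
offset-≰ {t} {n} {x} {y} t≤n ¬fits with ≤-total y x
... | inj₁ y≤x = <-≤-trans (+-monoˡ-< y (≰⇒> ¬fits)) (≤-reflexive (m+[n∸o]+o≡m+n t y≤x))
... | inj₂ x≤y rewrite m≤n⇒m∸n≡0 x≤y | +-identityʳ t = contradiction t≤n ¬fits

total : ∀ {n} → (Fin n → ℕ) → ℕ
total {zero}  _ = 0
total {suc n} M = M Fin.zero + total (M ∘ Fin.suc)

total-mono-≤ : ∀ {n} {M M′ : Fin n → ℕ} → (∀ p → M′ p ≤ M p) → total M′ ≤ total M
total-mono-≤ {zero}  _  = z≤n
total-mono-≤ {suc n} le = +-mono-≤ (le Fin.zero) (total-mono-≤ (le ∘ Fin.suc))

total-mono-< : ∀ {n} {M M′ : Fin n → ℕ} → (∀ p → M′ p ≤ M p) → (∃ λ p → M′ p < M p) → total M′ < total M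
total-mono-< le (Fin.zero  , lt) = +-mono-<-≤ lt (total-mono-≤ (le ∘ Fin.suc))
total-mono-< le (Fin.suc p , lt) = +-mono-≤-< (le Fin.zero) (total-mono-< (le ∘ Fin.suc) (p , lt))

strictly-below : ∀ {n} {M M′ : Fin n → ℕ} → (∀ p → M′ p ≤ M p) → ¬ M′ ≗ M → ∃ λ p → M′ p < M p
strictly-below {n} {M} {M′} le ¬≗ with ¬∀⟶∃¬ n (λ p → M′ p ≡ M p) (λ p → M′ p ≟ M p) ¬≗
... | p , ≢ = p , ≤∧≢⇒< (le p) ≢

total-≡⇒≗ : ∀ {n} {M M′ : Fin n → ℕ} → (∀ p → M′ p ≤ M p) → total M′ ≡ total M → M′ ≗ M
total-≡⇒≗ {M = M} {M′} le eq = decidable-stable (all? λ p → M′ p ≟ M p)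
  λ ¬≗ → <-irrefl eq (total-mono-< le (strictly-below le ¬≗))

≗-by-evaluation : ∀ {A : Set} (_≟ᴬ_ : DecidableEquality A) (f g : Fin 6 → A) →
  {True (all? λ p → f p ≟ᴬ g p)} → f ≗ g
≗-by-evaluation _ _ _ {ok} = toWitness ok

-- Balanced positions

position : ℕ → ℕ → ℕ → ℕ → ℕ → ℕ → Position 6
position a₀ a₁ a₂ a₃ a₄ a₅ 0F = a₀
position a₀ a₁ a₂ a₃ a₄ a₅ 1F = a₁
position a₀ a₁ a₂ a₃ a₄ a₅ 2F = a₂
position a₀ a₁ a₂ a₃ a₄ a₅ 3F = a₃
position a₀ a₁ a₂ a₃ a₄ a₅ 4F = a₄
position a₀ a₁ a₂ a₃ a₄ a₅ 5F = a₅

record Balanced₆ (a₀ a₁ a₂ a₃ a₄ a₅ : ℕ) : Set where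
  constructor balanced
  field
    sums   : a₀ + a₂ + a₄ ≡ a₁ + a₃ + a₅
    minima : NimZero (a₀ ⊓ a₃) (a₁ ⊓ a₄) (a₂ ⊓ a₅)

Balanced₆-cong : ∀ {a₀ a₁ a₂ a₃ a₄ a₅ b₀ b₁ b₂ b₃ b₄ b₅} →
  a₀ ≡ b₀ → a₁ ≡ b₁ → a₂ ≡ b₂ → a₃ ≡ b₃ → a₄ ≡ b₄ → a₅ ≡ b₅ →
  Balanced₆ a₀ a₁ a₂ a₃ a₄ a₅ → Balanced₆ b₀ b₁ b₂ b₃ b₄ b₅
Balanced₆-cong refl refl refl refl refl refl b = b

↻ : ∀ {a₀ a₁ a₂ a₃ a₄ a₅} → Balanced₆ a₀ a₁ a₂ a₃ a₄ a₅ → Balanced₆ a₁ a₂ a₃ a₄ a₅ a₀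
↻ {a₀} {a₁} {a₂} {a₃} {a₄} {a₅} (balanced sums minima) =
  balanced (trans (sym sums) (xy∙z≈yz∙x a₀ a₂ a₄))
           (subst (NimZero (a₁ ⊓ a₄) (a₂ ⊓ a₅)) (⊓-comm a₀ a₃) (NimZero-rotate minima))

Balanced₆-reflect : ∀ {a₀ a₁ a₂ a₃ a₄ a₅} → Balanced₆ a₀ a₁ a₂ a₃ a₄ a₅ → Balanced₆ a₀ a₅ a₄ a₃ a₂ a₁
Balanced₆-reflect {a₀} {a₁} {a₂} {a₃} {a₄} {a₅} (balanced sums minima) =
  balanced (trans (xy∙z≈xz∙y a₀ a₄ a₂) (trans sums (xy∙z≈zy∙x a₁ a₃ a₅)))
           (subst₂ (NimZero (a₀ ⊓ a₃)) (⊓-comm a₂ a₅) (⊓-comm a₁ a₄)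
                   (NimZero-swap (NimZero-rotate (NimZero-rotate minima))))

Balanced : Position 6 → Set
Balanced M = Balanced₆ (M 0F) (M 1F) (M 2F) (M 3F) (M 4F) (M 5F)

Balanced-resp : ∀ {M M′} → M ≗ M′ → Balanced M → Balanced M′
Balanced-resp eq = Balanced₆-cong (eq 0F) (eq 1F) (eq 2F) (eq 3F) (eq 4F) (eq 5F)

Balanced? : ∀ M → Dec (Balanced M)
Balanced? M with M 0F + M 2F + M 4F ≟ M 1F + M 3F + M 5F | (M 0F ⊓ M 3F) ⊕ (M 1F ⊓ M 4F) ⊕ (M 2F ⊓ M 5F) ≟ 0
... | yes sums | yes nim = yes (balanced sums (nimZero nim))
... | no ¬sums | _       = no (¬sums ∘ Balanced₆.sums)
... | _       | no ¬nim  = no (¬nim ∘ NimZero.⊕≡0 ∘ Balanced₆.minima)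

evens odds : Position 6 → ℕ
evens M = M 0F + M 2F + M 4F
odds  M = M 1F + M 3F + M 5F

total₆ : ∀ M → total M ≡ evens M + odds M
total₆ M = interleave (M 0F) (M 1F) (M 2F) (M 3F) (M 4F) (M 5F)
  where
  interleave : ∀ a b c d e f → a + (b + (c + (d + (e + (f + 0))))) ≡ (a + c + e) + (b + d + f)
  interleave = solve-∀

P6⇒Balanced₆ : ∀ {a₀ a₁ a₂ a₃ a₄ a₅} → P6 (position a₀ a₁ a₂ a₃ a₄ a₅) → Balanced₆ a₀ a₁ a₂ a₃ a₄ a₅
P6⇒Balanced₆ (sums , nim , l₀ , l₁ , l₂) =
  balanced sums (NimZero-cong (sym (m≤n⇒m⊓n≡m l₀)) (sym (m≤n⇒m⊓n≡m l₁)) (sym (m≤n⇒m⊓n≡m l₂)) (nimZero nim))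

Balanced₆⇒P6 : ∀ {a₀ a₁ a₂ a₃ a₄ a₅} → Balanced₆ a₀ a₁ a₂ a₃ a₄ a₅ →
  a₀ ≤ a₃ → a₁ ≤ a₄ → a₂ ≤ a₅ → P6 (position a₀ a₁ a₂ a₃ a₄ a₅)
Balanced₆⇒P6 (balanced sums minima) l₀ l₁ l₂ =
  sums , NimZero.⊕≡0 (NimZero-cong (m≤n⇒m⊓n≡m l₀) (m≤n⇒m⊓n≡m l₁) (m≤n⇒m⊓n≡m l₂) minima) , l₀ , l₁ , l₂

∈↺⇒Balanced : ∀ M → M ∈↺ P6 → Balanced M
∈↺⇒Balanced M (i , inj₁ b) = unrotate i (P6⇒Balanced₆ b)
  where
  unrotate : ∀ i → Balanced (λ p → M ((toℕ i + toℕ p) mod 6)) → Balanced M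
  unrotate 0F = id
  unrotate 1F = ↻ ∘ ↻ ∘ ↻ ∘ ↻ ∘ ↻
  unrotate 2F = ↻ ∘ ↻ ∘ ↻ ∘ ↻
  unrotate 3F = ↻ ∘ ↻ ∘ ↻
  unrotate 4F = ↻ ∘ ↻
  unrotate 5F = ↻
∈↺⇒Balanced M (i , inj₂ b) = unreflect i (P6⇒Balanced₆ b)
  where
  unreflect : ∀ i → Balanced (λ p → M ((toℕ i + (6 ∸ toℕ p)) mod 6)) → Balanced M
  unreflect 0F = Balanced₆-reflect
  unreflect 1F = ↻ ∘ ↻ ∘ ↻ ∘ ↻ ∘ ↻ ∘ Balanced₆-reflect
  unreflect 2F = ↻ ∘ ↻ ∘ ↻ ∘ ↻ ∘ Balanced₆-reflect
  unreflect 3F = ↻ ∘ ↻ ∘ ↻ ∘ Balanced₆-reflect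
  unreflect 4F = ↻ ∘ ↻ ∘ Balanced₆-reflect
  unreflect 5F = ↻ ∘ Balanced₆-reflect

Balanced⇒∈↺ : ∀ M → Balanced M → M ∈↺ P6
Balanced⇒∈↺ M b with ≤-total (M 0F) (M 3F) | ≤-total (M 1F) (M 4F) | ≤-total (M 2F) (M 5F)
... | inj₁ l₀ | inj₁ l₁ | inj₁ l₂ = 0F , inj₁ (Balanced₆⇒P6 b l₀ l₁ l₂)
... | inj₂ l₀ | inj₁ l₁ | inj₁ l₂ = 1F , inj₁ (Balanced₆⇒P6 (↻ b) l₁ l₂ l₀)
... | inj₂ l₀ | inj₂ l₁ | inj₁ l₂ = 2F , inj₁ (Balanced₆⇒P6 (↻ (↻ b)) l₂ l₀ l₁)
... | inj₂ l₀ | inj₂ l₁ | inj₂ l₂ = 3F , inj₁ (Balanced₆⇒P6 (↻ (↻ (↻ b))) l₀ l₁ l₂)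
... | inj₁ l₀ | inj₂ l₁ | inj₂ l₂ = 4F , inj₁ (Balanced₆⇒P6 (↻ (↻ (↻ (↻ b)))) l₁ l₂ l₀)
... | inj₁ l₀ | inj₁ l₁ | inj₂ l₂ = 5F , inj₁ (Balanced₆⇒P6 (↻ (↻ (↻ (↻ (↻ b))))) l₂ l₀ l₁)
... | inj₁ l₀ | inj₂ _  | inj₁ l₂ = 0F , inj₁ (Balanced₆⇒P6 b l₀ (middle-ordered (Balanced₆.sums b) l₀ l₂) l₂)
... | inj₂ l₀ | inj₁ _  | inj₂ l₂ = 3F , inj₁ (Balanced₆⇒P6 b³ l₀ (middle-ordered (Balanced₆.sums b³) l₀ l₂) l₂)
  where b³ = ↻ (↻ (↻ b))

-- Moves as lowerings of a block of piles

next prev : Fin 6 → Fin 6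
next p = suc (toℕ p) mod 6
prev p = (toℕ p + 5) mod 6

next∘prev : ∀ p → next (prev p) ≡ p
next∘prev = ≗-by-evaluation Fin._≟_ _ _

rotate : Position 6 → Position 6
rotate M = M ∘ next

rotateⁿ : ℕ → Position 6 → Position 6
rotateⁿ zero    M = M
rotateⁿ (suc k) M = rotateⁿ k (rotate M)

-- Every move lowers the piles of a single block, because 2 and 3 divide 6.
data Block : Set where
  parity   : Fin 2 → Block
  opposite : Fin 3 → Block

inBlock : Block → Fin 6 → Bool
inBlock (parity r)   p = toℕ p % 2 ≡ᵇ toℕ r
inBlock (opposite r) p = toℕ p % 3 ≡ᵇ toℕ r

shift : Block → Block
shift (parity r)   = parity (suc (toℕ r) mod 2)
shift (opposite r) = opposite (suc (toℕ r) mod 3)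

inBlock-shift : ∀ β → inBlock (shift β) ∘ next ≗ inBlock β
inBlock-shift (parity 0F)   = ≗-by-evaluation Bool._≟_ _ _
inBlock-shift (parity 1F)   = ≗-by-evaluation Bool._≟_ _ _
inBlock-shift (opposite 0F) = ≗-by-evaluation Bool._≟_ _ _
inBlock-shift (opposite 1F) = ≗-by-evaluation Bool._≟_ _ _
inBlock-shift (opposite 2F) = ≗-by-evaluation Bool._≟_ _ _

record BlockMove (β : Block) (M M′ : Position 6) : Set where
  field
    decreasing : ∀ p → M′ p ≤ M p
    outside    : ∀ p → ¬ T (inBlock β p) → M′ p ≡ M p

BlockMove-rotate : ∀ {β M M′} → BlockMove (shift β) M M′ → BlockMove β (rotate M) (rotate M′)
BlockMove-rotate {β} mv = record
  { decreasing = decreasing ∘ next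
  ; outside    = λ p ∉ → outside (next p) (∉ ∘ subst T (inBlock-shift β p))
  }
  where open BlockMove mv

BlockMove-unrotate : ∀ {β M N′} → BlockMove β (rotate M) N′ → BlockMove (shift β) M (N′ ∘ prev)
BlockMove-unrotate {β} {M} {N′} mv = record
  { decreasing = λ p → subst (N′ (prev p) ≤_) (cong M (next∘prev p)) (decreasing (prev p))
  ; outside    = λ p ∉ → trans (outside (prev p) (∉ ∘ shifted p)) (cong M (next∘prev p))
  }
  where
  open BlockMove mv
  shifted : ∀ p → T (inBlock β (prev p)) → T (inBlock (shift β) p)
  shifted p = subst (T ∘ inBlock (shift β)) (next∘prev p) ∘ subst T (sym (inBlock-shift β (prev p)))

BlockMove-trans : ∀ {β M M′ M″} → BlockMove β M M′ → BlockMove β M′ M″ → BlockMove β M M″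
BlockMove-trans mv mv′ = record
  { decreasing = λ p → ≤-trans (BlockMove.decreasing mv′ p) (BlockMove.decreasing mv p)
  ; outside    = λ p ∉ → trans (BlockMove.outside mv′ p ∉) (BlockMove.outside mv p ∉)
  }

Selected⇒%-≡ : ∀ {m s j} {i p : Fin m} .{{_ : NonZero m}} .{{_ : NonZero s}} →
  s ∣ m → Selected m s i j p → toℕ p % s ≡ toℕ i % s
Selected⇒%-≡ {m} {s} {i = i} {p} s∣m (t , _ , eq) = begin
  toℕ p % s                ≡⟨ cong (_% s) eq ⟩
  (toℕ i + t * s) % m % s  ≡⟨ m∣n⇒o%n%m≡o%m s m (toℕ i + t * s) s∣m ⟩
  (toℕ i + t * s) % s      ≡⟨ [m+kn]%n≡m%n (toℕ i) t s ⟩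
  toℕ i % s                ∎
  where open ≡-Reasoning

%-≡⇒Selected : ∀ {m s j} {i p : Fin m} .{{_ : NonZero m}} .{{_ : NonZero s}} →
  toℕ p % s ≡ toℕ i → toℕ p / s ≤ j → Selected m s i j p
%-≡⇒Selected {m} {s} {i = i} {p} residue bound = toℕ p / s , bound , (begin
  toℕ p                            ≡⟨ m<n⇒m%n≡m (toℕ<n p) ⟨
  toℕ p % m                        ≡⟨ cong (_% m) (m≡m%n+[m/n]*n (toℕ p) s) ⟩
  (toℕ p % s + toℕ p / s * s) % m  ≡⟨ cong (λ x → (x + toℕ p / s * s) % m) residue ⟩
  (toℕ i + toℕ p / s * s) % m      ∎)
  where open ≡-Reasoning

blockOf : ∀ {s} → s ∈ 2 ∷ 3 ∷ [] → Fin 6 → Block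
blockOf (here refl)         i = parity (toℕ i mod 2)
blockOf (there (here refl)) i = opposite (toℕ i mod 3)

Selected⇒inBlock : ∀ {s j i p} (s∈S : s ∈ 2 ∷ 3 ∷ []) → Selected 6 s i j p → T (inBlock (blockOf s∈S i) p)
Selected⇒inBlock {i = i} {p} (here refl) sel =
  ≡⇒≡ᵇ (toℕ p % 2) _ (trans (Selected⇒%-≡ {i = i} {p} (divides 3 refl) sel) (sym (toℕ-fromℕ< _)))
Selected⇒inBlock {i = i} {p} (there (here refl)) sel =
  ≡⇒≡ᵇ (toℕ p % 3) _ (trans (Selected⇒%-≡ {i = i} {p} (divides 2 refl) sel) (sym (toℕ-fromℕ< _)))

step : Block → ℕ
step (parity _)   = 2
step (opposite _) = 3

step∈S : ∀ β → step β ∈ 2 ∷ 3 ∷ []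
step∈S (parity _)   = here refl
step∈S (opposite _) = there (here refl)

start : Block → Fin 6
start (parity r)   = r ↑ˡ 4
start (opposite r) = r ↑ˡ 3

inBlock⇒Selected : ∀ β p → T (inBlock β p) → Selected 6 (step β) (start β) 2 p
inBlock⇒Selected (parity r) p ∈β =
  %-≡⇒Selected (trans (≡ᵇ⇒≡ _ _ ∈β) (sym (toℕ-↑ˡ r 4))) (/-mono-≤ (toℕ≤pred[n] p) ≤-refl)
inBlock⇒Selected (opposite r) p ∈β =
  %-≡⇒Selected (trans (≡ᵇ⇒≡ _ _ ∈β) (sym (toℕ-↑ˡ r 3))) (/-mono-≤ (toℕ≤pred[n] p) (s≤s (s≤s z≤n)))

Move : Position 6 → Position 6 → Set
Move = ECNMove 6 (2 ∷ 3 ∷ []) 3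

Move⇒BlockMove : ∀ {M M′} → Move M M′ → (∃ λ β → BlockMove β M M′) × (∃ λ p → M′ p < M p)
Move⇒BlockMove {M} {M′} (s , s∈S , i , j , _ , decreasing , selected , strict) =
  (blockOf s∈S i , record { decreasing = decreasing ; outside = outside }) , strict
  where
  outside : ∀ p → ¬ T (inBlock (blockOf s∈S i) p) → M′ p ≡ M p
  outside p ∉ with selected p
  ... | inj₁ sel  = contradiction (Selected⇒inBlock s∈S sel) ∉
  ... | inj₂ same = same

BlockMove⇒Move : ∀ {β M M′} → BlockMove β M M′ → (∃ λ p → M′ p < M p) → Move M M′
BlockMove⇒Move {β} {M} {M′} mv strict =
  step β , step∈S β , start β , 2 , ≤-refl , decreasing , selected , strict
  where
  open BlockMove mv
  selected : ∀ p → Selected 6 (step β) (start β) 2 p ⊎ M′ p ≡ M p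
  selected p with T? (inBlock β p)
  ... | yes ∈β = inj₁ (inBlock⇒Selected β p ∈β)
  ... | no ∉β  = inj₂ (outside p ∉β)

-- No move joins two balanced positions

Rigid : Block → Set
Rigid β = ∀ {M M′} → Balanced M → Balanced M′ → BlockMove β M M′ → M′ ≗ M

evens-rigid : Rigid (parity 0F)
evens-rigid {M} {M′} b b′ mv = total-≡⇒≗ decreasing (begin
  total M′            ≡⟨ total₆ M′ ⟩
  evens M′ + odds M′  ≡⟨ cong (_+ odds M′) (Balanced₆.sums b′) ⟩
  odds M′ + odds M′   ≡⟨ cong (λ x → x + x) odds-fixed ⟩
  odds M + odds M     ≡⟨ cong (_+ odds M) (Balanced₆.sums b) ⟨
  evens M + odds M    ≡⟨ total₆ M ⟨
  total M             ∎)
  where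
  open ≡-Reasoning
  open BlockMove mv
  odds-fixed : odds M′ ≡ odds M
  odds-fixed = cong₂ _+_ (cong₂ _+_ (outside 1F λ ()) (outside 3F λ ())) (outside 5F λ ())

opposite-rigid : Rigid (opposite 0F)
opposite-rigid {M} {M′} (balanced sums minima) b′ mv = pointwise
  where
  open BlockMove mv
  b″ : Balanced₆ (M′ 0F) (M 1F) (M 2F) (M′ 3F) (M 4F) (M 5F)
  b″ = Balanced₆-cong refl (outside 1F λ ()) (outside 2F λ ()) refl (outside 4F λ ()) (outside 5F λ ()) b′
  regroup : ∀ {a b} → a + M 2F + M 4F ≡ M 1F + b + M 5F → a + (M 2F + M 4F) ≡ b + (M 1F + M 5F)
  regroup {a} {b} eq = trans (sym (+-assoc a (M 2F) (M 4F))) (trans eq (xy∙z≈y∙xz (M 1F) b (M 5F)))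
  pair : M′ 0F ≡ M 0F × M′ 3F ≡ M 3F
  pair = pair-rigid (decreasing 0F) (decreasing 3F) (NimZero-unique (Balanced₆.minima b″) minima)
                    (regroup (Balanced₆.sums b″)) (regroup sums)
  pointwise : M′ ≗ M
  pointwise 0F = proj₁ pair
  pointwise 1F = outside 1F λ ()
  pointwise 2F = outside 2F λ ()
  pointwise 3F = proj₂ pair
  pointwise 4F = outside 4F λ ()
  pointwise 5F = outside 5F λ ()

Rigid-shift : ∀ {β} → Rigid β → Rigid (shift β)
Rigid-shift rigid {M} {M′} b b′ mv p = begin
  M′ p                ≡⟨ cong M′ (next∘prev p) ⟨
  M′ (next (prev p))  ≡⟨ rigid (↻ b) (↻ b′) (BlockMove-rotate mv) (prev p) ⟩
  M (next (prev p))   ≡⟨ cong M (next∘prev p) ⟩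
  M p                 ∎
  where open ≡-Reasoning

rigid : ∀ β → Rigid β
rigid (parity 0F)   = evens-rigid
rigid (parity 1F)   = Rigid-shift evens-rigid
rigid (opposite 0F) = opposite-rigid
rigid (opposite 1F) = Rigid-shift opposite-rigid
rigid (opposite 2F) = Rigid-shift (Rigid-shift opposite-rigid)

-- Every position can be balanced

BalancingMove : Position 6 → Set
BalancingMove M = ∃₂ λ β M′ → BlockMove β M M′ × Balanced M′

BalancingMove-unrotate : ∀ {M} → BalancingMove (rotate M) → BalancingMove M
BalancingMove-unrotate (β , N′ , mv , b) = shift β , N′ ∘ prev , BlockMove-unrotate mv , ↻ (↻ (↻ (↻ (↻ b))))

BalancingMove-unrotateⁿ : ∀ k {M} → BalancingMove (rotateⁿ k M) → BalancingMove M
BalancingMove-unrotateⁿ zero    = id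
BalancingMove-unrotateⁿ (suc k) = BalancingMove-unrotate ∘ BalancingMove-unrotateⁿ k

lower-evens : ∀ {N v₀ v₂ v₄} → v₀ ≤ N 0F → v₂ ≤ N 2F → v₄ ≤ N 4F →
  BlockMove (parity 0F) N (position v₀ (N 1F) v₂ (N 3F) v₄ (N 5F))
lower-evens {N} l₀ l₂ l₄ = record { decreasing = decreasing ; outside = outside }
  where
  decreasing : ∀ p → _ ≤ N p
  decreasing 0F = l₀
  decreasing 1F = ≤-refl
  decreasing 2F = l₂
  decreasing 3F = ≤-refl
  decreasing 4F = l₄
  decreasing 5F = ≤-refl
  outside : ∀ p → ¬ T (inBlock (parity 0F) p) → _ ≡ N p
  outside 0F ∉ = contradiction _ ∉
  outside 1F _ = refl
  outside 2F ∉ = contradiction _ ∉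
  outside 3F _ = refl
  outside 4F ∉ = contradiction _ ∉
  outside 5F _ = refl

lower-opposite : ∀ {N v₀ v₃} → v₀ ≤ N 0F → v₃ ≤ N 3F →
  BlockMove (opposite 0F) N (position v₀ (N 1F) (N 2F) v₃ (N 4F) (N 5F))
lower-opposite {N} l₀ l₃ = record { decreasing = decreasing ; outside = outside }
  where
  decreasing : ∀ p → _ ≤ N p
  decreasing 0F = l₀
  decreasing 1F = ≤-refl
  decreasing 2F = ≤-refl
  decreasing 3F = l₃
  decreasing 4F = ≤-refl
  decreasing 5F = ≤-refl
  outside : ∀ p → ¬ T (inBlock (opposite 0F) p) → _ ≡ N p
  outside 0F ∉ = contradiction _ ∉
  outside 1F _ = refl
  outside 2F _ = refl
  outside 3F ∉ = contradiction _ ∉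
  outside 4F _ = refl
  outside 5F _ = refl

evens-balancing : ∀ N → odds N ≤ evens N → NimZero (N 0F ⊓ N 3F) (N 1F ⊓ N 4F) (N 2F ⊓ N 5F) →
  ∃ λ N′ → BlockMove (parity 0F) N N′ × Balanced N′
evens-balancing N lo z
  with interval-sum₃ (m⊓n≤m (N 0F) (N 3F)) (m⊓n≤m (N 2F) (N 5F)) (m⊓n≤n (N 1F) (N 4F)) floor≤odds lo
  where
  floor≤odds : N 0F ⊓ N 3F + N 2F ⊓ N 5F + N 1F ⊓ N 4F ≤ odds N
  floor≤odds = ≤-trans (+-mono-≤ (+-mono-≤ (m⊓n≤n (N 0F) (N 3F)) (m⊓n≤n (N 2F) (N 5F))) (m⊓n≤m (N 1F) (N 4F)))
                       (≤-reflexive (xy∙z≈zx∙y (N 3F) (N 5F) (N 1F)))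
... | v₀ , v₂ , v₄ , (m₀≤v₀ , v₀≤n₀) , (m₂≤v₂ , v₂≤n₂) , (m₁≤v₄ , v₄≤n₄) , sum =
  position v₀ (N 1F) v₂ (N 3F) v₄ (N 5F) , lower-evens v₀≤n₀ v₂≤n₂ v₄≤n₄ ,
  balanced sum (NimZero-cong (sym (⊓-between m₀≤v₀ v₀≤n₀)) (sym minimum₁) (sym (⊓-between m₂≤v₂ v₂≤n₂)) z)
  where
  minimum₁ : N 1F ⊓ v₄ ≡ N 1F ⊓ N 4F
  minimum₁ = trans (⊓-comm (N 1F) v₄)
    (trans (⊓-between (subst (_≤ v₄) (⊓-comm (N 1F) (N 4F)) m₁≤v₄) v₄≤n₄) (⊓-comm (N 4F) (N 1F)))

-- The pair (t + (B ∸ A), t + (A ∸ B)) has minimum t and equalises the sums. If its second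
-- entry exceeds N 3F, lowering pile 0 to t instead leaves the evens at least as heavy.
opposite-balancing : ∀ N {t} → odds N ≤ evens N → t < N 0F ⊓ N 3F →
  NimZero t (N 1F ⊓ N 4F) (N 2F ⊓ N 5F) → BalancingMove N
opposite-balancing N {t} lo t<m z = by-cases (t + (A ∸ B) ≤? N 3F)
  where
  A B : ℕ
  A = N 2F + N 4F
  B = N 1F + N 5F
  t≤n₀ : t ≤ N 0F
  t≤n₀ = <⇒≤ (<-≤-trans t<m (m⊓n≤m (N 0F) (N 3F)))
  t≤n₃ : t ≤ N 3F
  t≤n₃ = <⇒≤ (<-≤-trans t<m (m⊓n≤n (N 0F) (N 3F)))
  regroup : ∀ a → N 1F + a + N 5F ≡ a + B
  regroup a = xy∙z≈y∙xz (N 1F) a (N 5F)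

  by-cases : Dec (t + (A ∸ B) ≤ N 3F) → BalancingMove N
  by-cases (yes fits) =
    opposite 0F , position a (N 1F) (N 2F) b (N 4F) (N 5F) , lower-opposite a≤n₀ fits ,
    balanced sums (NimZero-cong (sym (offsets-⊓ t A B)) refl refl z)
    where
    a b : ℕ
    a = t + (B ∸ A)
    b = t + (A ∸ B)
    a≤n₀ : a ≤ N 0F
    a≤n₀ = offset-≤ t≤n₀ (≤-trans (+-monoˡ-≤ B t≤n₃)
             (≤-trans (≤-reflexive (sym (regroup (N 3F)))) (≤-trans lo (≤-reflexive (+-assoc (N 0F) (N 2F) (N 4F))))))
    sums : a + N 2F + N 4F ≡ N 1F + b + N 5F
    sums = trans (+-assoc a (N 2F) (N 4F)) (trans (offsets-balance t A B) (sym (regroup b)))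
  by-cases (no ¬fits) with evens-balancing N₁ lo₁ z₁
    where
    N₁ = position t (N 1F) (N 2F) (N 3F) (N 4F) (N 5F)
    lo₁ : odds N₁ ≤ evens N₁
    lo₁ = ≤-trans (≤-reflexive (regroup (N 3F)))
            (≤-trans (<⇒≤ (offset-≰ t≤n₃ ¬fits)) (≤-reflexive (sym (+-assoc t (N 2F) (N 4F)))))
    z₁ : NimZero (t ⊓ N 3F) (N 1F ⊓ N 4F) (N 2F ⊓ N 5F)
    z₁ = NimZero-cong (sym (m≤n⇒m⊓n≡m t≤n₃)) refl refl z
  ... | N′ , mv , b = parity 0F , N′ , BlockMove-trans (lower-evens t≤n₀ ≤-refl ≤-refl) mv , b

-- Rotating by an even number of piles keeps evens and odds and cycles the opposite pairs.
balancing-move-evens-heavy : ∀ N → odds N ≤ evens N → BalancingMove N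
balancing-move-evens-heavy N lo with (N 0F ⊓ N 3F) ⊕ (N 1F ⊓ N 4F) ⊕ (N 2F ⊓ N 5F) ≟ 0
... | yes z with evens-balancing N lo (nimZero z)
...   | N′ , mv , b = parity 0F , N′ , mv , b
balancing-move-evens-heavy N lo | no ¬z with nim-move (N 0F ⊓ N 3F) (N 1F ⊓ N 4F) (N 2F ⊓ N 5F) ¬z
... | inj₁ (t , t<m₀ , z) = opposite-balancing N lo t<m₀ z
... | inj₂ (inj₁ (t , t<m₁ , z)) = BalancingMove-unrotateⁿ 4 (opposite-balancing (rotateⁿ 4 N)
    (subst₂ _≤_ (xy∙z≈zx∙y (N 1F) (N 3F) (N 5F)) (xy∙z≈zx∙y (N 0F) (N 2F) (N 4F)) lo)
    (subst (t <_) (⊓-comm (N 1F) (N 4F)) t<m₁)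
    (NimZero-cong refl (⊓-comm (N 2F) (N 5F)) refl (NimZero-rotate z)))
... | inj₂ (inj₂ (t , t<m₂ , z)) = BalancingMove-unrotateⁿ 2 (opposite-balancing (rotateⁿ 2 N)
    (subst₂ _≤_ (xy∙z≈yz∙x (N 1F) (N 3F) (N 5F)) (xy∙z≈yz∙x (N 0F) (N 2F) (N 4F)) lo)
    t<m₂
    (NimZero-cong refl (⊓-comm (N 0F) (N 3F)) (⊓-comm (N 1F) (N 4F)) (NimZero-rotate (NimZero-rotate z))))

balancing-move : ∀ N → BalancingMove N
balancing-move N with ≤-total (odds N) (evens N)
... | inj₁ lo = balancing-move-evens-heavy N lo
... | inj₂ hi = BalancingMove-unrotate
                  (balancing-move-evens-heavy (rotate N) (subst (_≤ odds N) (xy∙z≈yz∙x (N 0F) (N 2F) (N 4F)) hi))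

Move-shrinks : ∀ {M M′} → Move M M′ → total M′ < total M
Move-shrinks mv with Move⇒BlockMove mv
... | (_ , bm) , strict = total-mono-< (BlockMove.decreasing bm) strict

no-move-between-balanced : ∀ {M M′} → Balanced M → Move M M′ → ¬ Balanced M′
no-move-between-balanced b mv b′ with Move⇒BlockMove mv
... | (β , bm) , (p , lt) = <-irrefl (rigid β b b′ bm p) lt

move-to-balanced : ∀ {M} → ¬ Balanced M → ∃ λ M′ → Move M M′ × Balanced M′
move-to-balanced {M} ¬b with balancing-move M
... | _ , M′ , bm , b′ =
  M′ , BlockMove⇒Move bm (strictly-below (BlockMove.decreasing bm) (λ M′≗M → ¬b (Balanced-resp M′≗M b′))) , b′

mainTheorem6 : (M : Position 6) →
    ECN-P-position 6 (2 ∷ 3 ∷ []) 3 M ⇔ (M ∈↺ P6)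
mainTheorem6 M = mk⇔ (Balanced⇒∈↺ M) (∈↺⇒Balanced M) ⇔-∘ IsP⇔Balanced
  where
  IsP⇔Balanced : ECN-P-position 6 (2 ∷ 3 ∷ []) 3 M ⇔ Balanced M
  IsP⇔Balanced = IsP⇔kernel Balanced Balanced? total Move-shrinks no-move-between-balanced move-to-balanced M
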